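{- There exists a rational $4$-simplex $S\subset\mathbb{R}^4$, hollow with respect to $\mathbb{Z}^4$, of lattice width $4+\frac4{101}$ with respect to $\mathbb{Z}^4$, having a vertex in $\mathbb{Z}^4$, and such that its dilation $101S$ is a lattice simplex.
   Context: A convex body is hollow with respect to $\mathbb{Z}^4$ if its interior contains no integer point. The lattice width of $K$ is $\inf_{f\in(\mathbb{Z}^4)^*\setminus\{0\}}(\max_K f-\min_K f)$. A lattice simplex has all vertices in $\mathbb{Z}^4$; $kS$ denotes dilation by factor $k$. -}

module Defs where

open import Data.Nat using (ℕ; zero; suc)
open import Data.Fin using (Fin; zero; suc)
open import Data.Integer using (ℤ)
open import Data.Rational using (ℚ; 0ℚ; 1ℚ; _+_; _*_; _-_; _≤_; _<_; _⊔_; _⊓_; _/_)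
open import Data.Product using (Σ; ∃; _×_; _,_)
open import Relation.Binary.PropositionalEquality using (_≡_)
open import Relation.Nullary using (¬_)

ιℤ : ℤ → ℚ
ιℤ z = z / 1

Pt : ℕ → Set
Pt d = Fin d → ℚ

ZPt : ℕ → Set
ZPt d = Fin d → ℤ

ιPt : ∀ {d} → ZPt d → Pt d
ιPt z i = ιℤ (z i)

∑ : ∀ n → (Fin n → ℚ) → ℚ
∑ zero    f = 0ℚ
∑ (suc n) f = f zero + ∑ n (λ i → f (suc i))

maxF : ∀ n → (Fin (suc n) → ℚ) → ℚ
maxF zero    f = f zero
maxF (suc n) f = f zero ⊔ maxF n (λ i → f (suc i))

minF : ∀ n → (Fin (suc n) → ℚ) → ℚ
minF zero    f = f zero
minF (suc n) f = f zero ⊓ minF n (λ i → f (suc i))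

eval : ∀ {d} → ZPt d → Pt d → ℚ
eval {d} f x = ∑ d (λ i → ιℤ (f i) * x i)

lincomb : ∀ {n d} → (Fin n → ℚ) → (Fin n → Pt d) → Pt d
lincomb {n} l v j = ∑ n (λ i → l i * v i j)

NonZeroFunctional : ∀ {d} → ZPt d → Set
NonZeroFunctional {d} f = ¬ (∀ i → f i ≡ Data.Integer.0ℤ)
  where import Data.Integer

Simplex : ℕ → Set
Simplex d = Fin (suc d) → Pt d

AffinelyIndependent : ∀ {d} → Simplex d → Set
AffinelyIndependent {d} v =
  (l : Fin (suc d) → ℚ) → ∑ (suc d) l ≡ 0ℚ → (∀ j → lincomb l v j ≡ 0ℚ) → ∀ i → l i ≡ 0ℚ

-- interior of the (full-dimensional) simplex: strictly positive barycentric coordinates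
InInterior : ∀ {d} → Simplex d → Pt d → Set
InInterior {d} v x =
  Σ (Fin (suc d) → ℚ) λ l → (∀ i → 0ℚ < l i) × (∑ (suc d) l ≡ 1ℚ) × (∀ j → lincomb l v j ≡ x j)

Hollow : ∀ {d} → Simplex d → Set
Hollow {d} v = (z : ZPt d) → ¬ InInterior v (ιPt z)

-- width of conv(v) in direction f: max_K f - min_K f (attained at vertices)
widthIn : ∀ {d} → Simplex d → ZPt d → ℚ
widthIn {d} v f = maxF d (λ i → eval f (v i)) - minF d (λ i → eval f (v i))

LatticeWidthIs : ∀ {d} → Simplex d → ℚ → Set
LatticeWidthIs {d} v w =
  ((f : ZPt d) → NonZeroFunctional f → w ≤ widthIn v f) ×
  ((ε : ℚ) → 0ℚ < ε → Σ (ZPt d) λ f → NonZeroFunctional f × (widthIn v f < w + ε))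

HasLatticeVertex : ∀ {d} → Simplex d → Set
HasLatticeVertex {d} v = Σ (Fin (suc d)) λ i → Σ (ZPt d) λ z → v i ≡ ιPt z

DilationIsLattice : ∀ {d} → ℚ → Simplex d → Set
DilationIsLattice {d} k v = ∀ i → Σ (ZPt d) λ z → ∀ j → k * v i j ≡ ιℤ (z j)

{-# OPTIONS --safe #-}
-- S is (102/101)·T for the lattice simplex T = conv(0, e₀, e₁, e₂, a), a = (6, 14, 17, 101),
-- so 101·S = 102·T is a lattice simplex with the vertex 0.  An integer functional f takes the
-- integer values 0, f₀, f₁, f₂ and e = 6f₀ + 14f₁ + 17f₂ + 101f₃ on the vertices of T.  If their
-- spread is below 4 they all lie in [-3, 3], and a finite search over such values with
-- 101 ∣ e − 6f₀ − 14f₁ − 17f₂ forces f = 0; so the lattice width of S is at least 4·102/101,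
-- and (-3, 0, 1, 0) attains it.
-- A lattice point z of S has barycentric coordinates λ with 102λ = (·, N₀, N₁, N₂, z₃), where
-- Nⱼ = 101zⱼ − aⱼz₃ ≡ −aⱼz₃ (mod 101).  If z is interior these are positive integers, so each Nⱼ
-- is at least the least positive n ≡ −aⱼz₃; checking t = z₃ ≤ 101 shows N₀ + N₁ + N₂ + z₃ ≥ 102,
-- contradicting λ₀ > 0.
module Submission where

open import Defs
open import Data.Integer using (+_)
open import Data.Rational using (ℚ; _/_)
import Data.Rational as ℚ
open import Data.Product using (Σ; _×_)

open import Function using (_∘_)
open import Data.Nat as ℕ using (ℕ)
import Data.Nat.Properties as ℕP
import Data.Nat.Divisibility as ℕD
import Data.Nat.DivMod as ℕDM
import Data.Nat.Coprimality as Coprime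
open import Data.Fin using (Fin; zero; suc; #_; inject₁)
import Data.Fin.Properties as FinP
import Data.Vec as Vec
open import Data.Vec using ([]; _∷_)
open import Data.Integer as ℤ using (ℤ; -[1+_])
import Data.Integer.Properties as ℤP
import Data.Integer.Divisibility.Signed as ℤD
open import Data.Integer.Tactic.RingSolver using (solve-∀)
import Data.Nat.Tactic.RingSolver as ℕSolver
open import Data.Rational using (mkℚ; 0ℚ; 1ℚ; _+_; _*_; _-_; -_; _≤_; _<_; *≤*; *<*; 1/_)
import Data.Rational.Properties as ℚP
import Data.Rational.Solver as ℚSolver
open import Data.Product using (_,_; proj₁; proj₂)
open import Data.Empty using (⊥; ⊥-elim)
open import Data.List using (List; []; _∷_)
open import Data.List.Relation.Unary.All as All using (All)
open import Data.List.Relation.Unary.Any using (here; there)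
open import Data.List.Membership.Propositional using (_∈_)
open import Relation.Nullary using (Dec; yes; no)
open import Relation.Nullary.Decidable using (from-yes; _×-dec_; _→-dec_)
open import Relation.Binary.PropositionalEquality

-- Over denominator 1 the normalisation hidden in _/_ is the identity, so ιℤ z is the raw
-- fraction z/1, on which the operations of ℚ compute.
ιℤ≡mkℚ : ∀ z → ιℤ z ≡ mkℚ z 0 (Coprime.sym (Coprime.1-coprimeTo ℤ.∣ z ∣))
ιℤ≡mkℚ z = ℚP.↥p/↧p≡p _

ιℤ-+ : ∀ a b → ιℤ (a ℤ.+ b) ≡ ιℤ a + ιℤ b
ιℤ-+ a b rewrite ιℤ≡mkℚ a | ιℤ≡mkℚ b =
  cong (_/ 1) (sym (cong₂ ℤ._+_ (ℤP.*-identityʳ a) (ℤP.*-identityʳ b)))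

ιℤ-* : ∀ a b → ιℤ (a ℤ.* b) ≡ ιℤ a * ιℤ b
ιℤ-* a b rewrite ιℤ≡mkℚ a | ιℤ≡mkℚ b = refl

ιℤ-neg : ∀ a → ιℤ (ℤ.- a) ≡ - ιℤ a
ιℤ-neg (+ ℕ.zero)  = refl
ιℤ-neg (+ ℕ.suc n) = refl
ιℤ-neg -[1+ n ] rewrite ιℤ≡mkℚ -[1+ n ] | ιℤ≡mkℚ (+ ℕ.suc n) = refl

ιℤ-- : ∀ a b → ιℤ (a ℤ.- b) ≡ ιℤ a - ιℤ b
ιℤ-- a b = trans (ιℤ-+ a (ℤ.- b)) (cong (λ q → ιℤ a + q) (ιℤ-neg b))

ιℤ-mono-≤ : ∀ {a b} → a ℤ.≤ b → ιℤ a ≤ ιℤ b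
ιℤ-mono-≤ {a} {b} a≤b rewrite ιℤ≡mkℚ a | ιℤ≡mkℚ b =
  *≤* (subst₂ ℤ._≤_ (sym (ℤP.*-identityʳ a)) (sym (ℤP.*-identityʳ b)) a≤b)

ιℤ-cancel-< : ∀ {a b} → ιℤ a < ιℤ b → a ℤ.< b
ιℤ-cancel-< {a} {b} a<b rewrite ιℤ≡mkℚ a | ιℤ≡mkℚ b with a<b
... | *<* a*1<b*1 = subst₂ ℤ._<_ (ℤP.*-identityʳ a) (ℤP.*-identityʳ b) a*1<b*1

⟨_,_⟩ : ∀ {d} → ZPt d → ZPt d → ℤ
⟨_,_⟩ {ℕ.zero}  f z = + 0
⟨_,_⟩ {ℕ.suc d} f z = f zero ℤ.* z zero ℤ.+ ⟨ f ∘ suc , z ∘ suc ⟩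

unit : ∀ {d} → Fin d → ZPt d
unit zero    zero    = + 1
unit zero    (suc i) = + 0
unit (suc j) zero    = + 0
unit (suc j) (suc i) = unit j i

⟨⟩-zeroʳ : ∀ {d} (f : ZPt d) → ⟨ f , (λ _ → + 0) ⟩ ≡ + 0
⟨⟩-zeroʳ {ℕ.zero}  f = refl
⟨⟩-zeroʳ {ℕ.suc d} f = cong₂ ℤ._+_ (ℤP.*-zeroʳ (f zero)) (⟨⟩-zeroʳ (f ∘ suc))

⟨⟩-unitʳ : ∀ {d} (f : ZPt d) j → ⟨ f , unit j ⟩ ≡ f j
⟨⟩-unitʳ {ℕ.suc d} f zero = begin
  f zero ℤ.* + 1 ℤ.+ ⟨ f ∘ suc , (λ _ → + 0) ⟩ ≡⟨ cong₂ ℤ._+_ (ℤP.*-identityʳ (f zero)) (⟨⟩-zeroʳ (f ∘ suc)) ⟩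
  f zero ℤ.+ + 0                               ≡⟨ ℤP.+-identityʳ (f zero) ⟩
  f zero                                       ∎
  where open ≡-Reasoning
⟨⟩-unitʳ {ℕ.suc d} f (suc j) =
  trans (cong₂ ℤ._+_ (ℤP.*-zeroʳ (f zero)) (⟨⟩-unitʳ (f ∘ suc) j)) (ℤP.+-identityˡ (f (suc j)))

eval-ιPt : ∀ {d} (f z : ZPt d) → eval f (ιPt z) ≡ ιℤ ⟨ f , z ⟩
eval-ιPt {ℕ.zero}  f z = refl
eval-ιPt {ℕ.suc d} f z = begin
  ιℤ (f zero) * ιℤ (z zero) + eval (f ∘ suc) (ιPt (z ∘ suc)) ≡⟨ cong₂ _+_ (sym (ιℤ-* (f zero) (z zero))) (eval-ιPt (f ∘ suc) (z ∘ suc)) ⟩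
  ιℤ (f zero ℤ.* z zero) + ιℤ ⟨ f ∘ suc , z ∘ suc ⟩           ≡⟨ sym (ιℤ-+ (f zero ℤ.* z zero) ⟨ f ∘ suc , z ∘ suc ⟩) ⟩
  ιℤ ⟨ f , z ⟩                                                 ∎
  where open ≡-Reasoning

_•_ : ∀ {d} → ℚ → Pt d → Pt d
(c • x) j = c * x j

eval-• : ∀ {d} (f : ZPt d) c x → eval f (c • x) ≡ c * eval f x
eval-• {ℕ.zero}  f c x = sym (ℚP.*-zeroʳ c)
eval-• {ℕ.suc d} f c x =
  trans (cong (λ e → ιℤ (f zero) * (c * x zero) + e) (eval-• (f ∘ suc) c (x ∘ suc)))
        (factor (ιℤ (f zero)) c (x zero) (eval (f ∘ suc) (x ∘ suc)))
  where
  open ℚSolver.+-*-Solver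
  factor : ∀ a c y e → a * (c * y) + c * e ≡ c * (a * y + e)
  factor = solve 4 (λ a c y e → a :* (c :* y) :+ c :* e := c :* (a :* y :+ e)) refl

≤-maxF : ∀ n (g : Fin (ℕ.suc n) → ℚ) i → g i ≤ maxF n g
≤-maxF ℕ.zero    g zero    = ℚP.≤-refl
≤-maxF (ℕ.suc n) g zero    = ℚP.p≤p⊔q (g zero) _
≤-maxF (ℕ.suc n) g (suc i) = ℚP.≤-trans (≤-maxF n (g ∘ suc) i) (ℚP.p≤q⊔p (g zero) _)

minF-≤ : ∀ n (g : Fin (ℕ.suc n) → ℚ) i → minF n g ≤ g i
minF-≤ ℕ.zero    g zero    = ℚP.≤-refl
minF-≤ (ℕ.suc n) g zero    = ℚP.p⊓q≤p (g zero) _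
minF-≤ (ℕ.suc n) g (suc i) = ℚP.≤-trans (ℚP.p⊓q≤q (g zero) _) (minF-≤ n (g ∘ suc) i)

eval-gap≤widthIn : ∀ {d} (v : Simplex d) f i j → eval f (v i) - eval f (v j) ≤ widthIn v f
eval-gap≤widthIn {d} v f i j =
  ℚP.+-mono-≤ (≤-maxF d (eval f ∘ v) i) (ℚP.neg-antimono-≤ (minF-≤ d (eval f ∘ v) j))

*≡0⇒≡0 : ∀ p .{{_ : ℚ.NonZero p}} {q} → p * q ≡ 0ℚ → q ≡ 0ℚ
*≡0⇒≡0 p {q} pq≡0 = begin
  q                ≡⟨ sym (ℚP.*-identityˡ q) ⟩
  1ℚ * q           ≡⟨ cong (_* q) (sym (ℚP.*-inverseˡ p)) ⟩
  (1/ p * p) * q   ≡⟨ ℚP.*-assoc (1/ p) p q ⟩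
  1/ p * (p * q)   ≡⟨ cong (1/ p *_) pq≡0 ⟩
  1/ p * 0ℚ        ≡⟨ ℚP.*-zeroʳ (1/ p) ⟩
  0ℚ               ∎
  where open ≡-Reasoning

∑-zero : ∀ n (g : Fin n → ℚ) → (∀ i → g i ≡ 0ℚ) → ∑ n g ≡ 0ℚ
∑-zero ℕ.zero    g g≡0 = refl
∑-zero (ℕ.suc n) g g≡0 = cong₂ _+_ (g≡0 zero) (∑-zero n (g ∘ suc) (g≡0 ∘ suc))

apex : ZPt 4
apex = Vec.lookup (+ 6 ∷ + 14 ∷ + 17 ∷ + 101 ∷ [])

T : Fin 5 → ZPt 4
T = Vec.lookup ((λ _ → + 0) ∷ unit (# 0) ∷ unit (# 1) ∷ unit (# 2) ∷ apex ∷ [])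

k : ℚ
k = (+ 102) / 101

S : Simplex 4
S i = k • ιPt (T i)

101•S-integral : DilationIsLattice ((+ 101) / 1) S
101•S-integral i = (λ j → + 102 ℤ.* T i j) , λ j → 101·k (T i j)
  where
  101·k : ∀ a → (+ 101) / 1 * (k * ιℤ a) ≡ ιℤ (+ 102 ℤ.* a)
  101·k a = trans (sym (ℚP.*-assoc ((+ 101) / 1) k (ιℤ a))) (sym (ιℤ-* (+ 102) a))

S-vertex₀ : HasLatticeVertex S
S-vertex₀ = zero , (λ _ → + 0) , refl

-- Lattice width

eval-S : ∀ f i → eval f (S i) ≡ k * ιℤ ⟨ f , T i ⟩
eval-S f i = trans (eval-• f k (ιPt (T i))) (cong (k *_) (eval-ιPt f (T i)))

vertexValues : ℤ → ℤ → ℤ → ℤ → Fin 5 → ℤ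
vertexValues a b c e = Vec.lookup (+ 0 ∷ a ∷ b ∷ c ∷ e ∷ [])

⟨⟩-T : ∀ f i → ⟨ f , T i ⟩ ≡ vertexValues (f (# 0)) (f (# 1)) (f (# 2)) ⟨ f , apex ⟩ i
⟨⟩-T f zero                   = ⟨⟩-zeroʳ f
⟨⟩-T f (suc zero)             = ⟨⟩-unitʳ f (# 0)
⟨⟩-T f (suc (suc zero))       = ⟨⟩-unitʳ f (# 1)
⟨⟩-T f (suc (suc (suc zero))) = ⟨⟩-unitʳ f (# 2)
⟨⟩-T f (suc (suc (suc (suc zero)))) = refl

residue : ℤ → ℤ → ℤ → ℤ → ℤ
residue a b c e = e ℤ.- (+ 6 ℤ.* a ℤ.+ + 14 ℤ.* b ℤ.+ + 17 ℤ.* c)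

residue-apex : ∀ f → residue (f (# 0)) (f (# 1)) (f (# 2)) ⟨ f , apex ⟩ ≡ f (# 3) ℤ.* + 101
residue-apex f = identity (f (# 0)) (f (# 1)) (f (# 2)) (f (# 3))
  where
  identity : ∀ a b c d →
    (a ℤ.* + 6 ℤ.+ (b ℤ.* + 14 ℤ.+ (c ℤ.* + 17 ℤ.+ (d ℤ.* + 101 ℤ.+ + 0))))
      ℤ.- (+ 6 ℤ.* a ℤ.+ + 14 ℤ.* b ℤ.+ + 17 ℤ.* c) ≡ d ℤ.* + 101
  identity = solve-∀

Narrow : (Fin 5 → ℤ) → Set
Narrow h = ∀ i j → h i ℤ.- h j ℤ.< + 4

small : List ℤ
small = -[1+ 2 ] ∷ -[1+ 1 ] ∷ -[1+ 0 ] ∷ + 0 ∷ + 1 ∷ + 2 ∷ + 3 ∷ []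

∈-small : ∀ x → x ℤ.- + 0 ℤ.< + 4 → + 0 ℤ.- x ℤ.< + 4 → x ∈ small
∈-small -[1+ 2 ] _ _ = here refl
∈-small -[1+ 1 ] _ _ = there (here refl)
∈-small -[1+ 0 ] _ _ = there (there (here refl))
∈-small (+ 0)    _ _ = there (there (there (here refl)))
∈-small (+ 1)    _ _ = there (there (there (there (here refl))))
∈-small (+ 2)    _ _ = there (there (there (there (there (here refl)))))
∈-small (+ 3)    _ _ = there (there (there (there (there (there (here refl))))))
∈-small (+ ℕ.suc (ℕ.suc (ℕ.suc (ℕ.suc _)))) (ℤ.+<+ (ℕ.s≤s (ℕ.s≤s (ℕ.s≤s (ℕ.s≤s ()))))) _
∈-small -[1+ ℕ.suc (ℕ.suc (ℕ.suc _)) ] _ (ℤ.+<+ (ℕ.s≤s (ℕ.s≤s (ℕ.s≤s (ℕ.s≤s ())))))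

NarrowResidueVanishes : ℤ → ℤ → ℤ → ℤ → Set
NarrowResidueVanishes a b c e =
  + 101 ℤD.∣ residue a b c e → Narrow (vertexValues a b c e) →
  a ≡ + 0 × b ≡ + 0 × c ≡ + 0 × residue a b c e ≡ + 0

abstract
  narrowResidueVanishes-small :
    All (λ a → All (λ b → All (λ c → All (NarrowResidueVanishes a b c) small) small) small) small
  narrowResidueVanishes-small = from-yes
    (All.all? (λ a → All.all? (λ b → All.all? (λ c → All.all? (λ e → decide a b c e) small) small) small) small)
    where
    decide : ∀ a b c e → Dec (NarrowResidueVanishes a b c e)
    decide a b c e =
      (+ 101 ℤD.∣? residue a b c e) →-dec
      FinP.all? (λ i → FinP.all? (λ j → vertexValues a b c e i ℤ.- vertexValues a b c e j ℤ.<? + 4)) →-dec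
      (a ℤP.≟ + 0) ×-dec (b ℤP.≟ + 0) ×-dec (c ℤP.≟ + 0) ×-dec (residue a b c e ℤP.≟ + 0)

narrowResidueVanishes : ∀ a b c e → NarrowResidueVanishes a b c e
narrowResidueVanishes a b c e 101∣r narrow =
  All.lookup (All.lookup (All.lookup (All.lookup narrowResidueVanishes-small
    (∈-small a (narrow (# 1) (# 0)) (narrow (# 0) (# 1))))
    (∈-small b (narrow (# 2) (# 0)) (narrow (# 0) (# 2))))
    (∈-small c (narrow (# 3) (# 0)) (narrow (# 0) (# 3))))
    (∈-small e (narrow (# 4) (# 0)) (narrow (# 0) (# 4)))
    101∣r narrow

T-spread : ∀ f → NonZeroFunctional f → Σ (Fin 5) λ i → Σ (Fin 5) λ j → + 4 ℤ.≤ ⟨ f , T i ⟩ ℤ.- ⟨ f , T j ⟩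
T-spread f f≢0 with FinP.any? (λ i → FinP.any? (λ j → + 4 ℤP.≤? ⟨ f , T i ⟩ ℤ.- ⟨ f , T j ⟩))
... | yes gap = gap
... | no ¬gap = ⊥-elim (f≢0 f≡0)
  where
  narrow : Narrow (vertexValues (f (# 0)) (f (# 1)) (f (# 2)) ⟨ f , apex ⟩)
  narrow i j = subst₂ (λ u v → u ℤ.- v ℤ.< + 4) (⟨⟩-T f i) (⟨⟩-T f j) (ℤP.≰⇒> (λ 4≤ → ¬gap (i , j , 4≤)))
  vanish : f (# 0) ≡ + 0 × f (# 1) ≡ + 0 × f (# 2) ≡ + 0 × residue (f (# 0)) (f (# 1)) (f (# 2)) ⟨ f , apex ⟩ ≡ + 0
  vanish = narrowResidueVanishes _ _ _ _ (ℤD.divides (f (# 3)) (residue-apex f)) narrow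
  f≡0 : ∀ i → f i ≡ + 0
  f≡0 zero                   = proj₁ vanish
  f≡0 (suc zero)             = proj₁ (proj₂ vanish)
  f≡0 (suc (suc zero))       = proj₁ (proj₂ (proj₂ vanish))
  f≡0 (suc (suc (suc zero))) =
    ℤP.*-cancelʳ-≡ (f (# 3)) (+ 0) (+ 101) (trans (sym (residue-apex f)) (proj₂ (proj₂ (proj₂ vanish))))

vertex-gap⇒widthIn-S-≥ : ∀ f i j → + 4 ℤ.≤ ⟨ f , T i ⟩ ℤ.- ⟨ f , T j ⟩ → (+ 408) / 101 ≤ widthIn S f
vertex-gap⇒widthIn-S-≥ f i j 4≤gap = begin
  k * ιℤ (+ 4)                              ≤⟨ ℚP.*-monoˡ-≤-nonNeg k (ιℤ-mono-≤ 4≤gap) ⟩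
  k * ιℤ (⟨ f , T i ⟩ ℤ.- ⟨ f , T j ⟩)      ≡⟨ cong (k *_) (ιℤ-- ⟨ f , T i ⟩ ⟨ f , T j ⟩) ⟩
  k * (ιℤ ⟨ f , T i ⟩ - ιℤ ⟨ f , T j ⟩)     ≡⟨ *-distribˡ-- k (ιℤ ⟨ f , T i ⟩) (ιℤ ⟨ f , T j ⟩) ⟩
  k * ιℤ ⟨ f , T i ⟩ - k * ιℤ ⟨ f , T j ⟩   ≡⟨ sym (cong₂ _-_ (eval-S f i) (eval-S f j)) ⟩
  eval f (S i) - eval f (S j)               ≤⟨ eval-gap≤widthIn S f i j ⟩
  widthIn S f                               ∎
  where
  open ℚP.≤-Reasoning
  *-distribˡ-- : ∀ p q r → p * (q - r) ≡ p * q - p * r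
  *-distribˡ-- p q r = trans (ℚP.*-distribˡ-+ p q (- r)) (cong (λ s → p * q + s) (sym (ℚP.neg-distribʳ-* p r)))

widthIn-S-≥ : ∀ f → NonZeroFunctional f → (+ 408) / 101 ≤ widthIn S f
widthIn-S-≥ f f≢0 = let i , j , 4≤gap = T-spread f f≢0 in vertex-gap⇒widthIn-S-≥ f i j 4≤gap

-- f* takes the values 0, -3, 0, 1, -1 on the vertices of T.
f* : ZPt 4
f* = Vec.lookup (-[1+ 2 ] ∷ + 0 ∷ + 1 ∷ + 0 ∷ [])

widthIn-S-f* : widthIn S f* ≡ (+ 408) / 101
widthIn-S-f* = refl

f*≢0 : NonZeroFunctional f*
f*≢0 f*≡0 with f*≡0 zero
... | ()

widthIn-S-approached : ∀ ε → 0ℚ < ε → Σ (ZPt 4) λ f → NonZeroFunctional f × (widthIn S f < (+ 408) / 101 + ε)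
widthIn-S-approached ε ε>0 =
  f* , f*≢0 , subst (_< (+ 408) / 101 + ε) (sym widthIn-S-f*) (ℚP.+-monoʳ-< ((+ 408) / 101) ε>0)

-- Barycentric coordinates and affine independence

module _ where
  open ℚSolver.+-*-Solver

  ∑ᴾ : ∀ {m} n → (Fin n → Polynomial m) → Polynomial m
  ∑ᴾ ℕ.zero    p = con 0ℚ
  ∑ᴾ (ℕ.suc n) p = p zero :+ ∑ᴾ n (p ∘ suc)

  -- ⟦ lincombᴾ j ⟧ evaluated at the coordinates l computes to lincomb l S j,
  -- which lets the ring solver prove linear relations between l and lincomb l S.
  lincombᴾ : Fin 4 → Polynomial 5
  lincombᴾ j = ∑ᴾ 5 (λ i → var i :* con (S i j))

  102·lᴾ : Fin 5 → Polynomial 5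
  102·lᴾ i = con (ιℤ (+ 102)) :* var i

  unitRelationᴾ : Fin 3 → Polynomial 5
  unitRelationᴾ j =
    con (ιℤ (+ 101)) :* lincombᴾ (inject₁ j) :- con (ιℤ (apex (inject₁ j))) :* lincombᴾ (# 3)

  apex-coordinate : ∀ l → ιℤ (+ 102) * l (# 4) ≡ lincomb l S (# 3)
  apex-coordinate l = prove (Vec.tabulate l) (102·lᴾ (# 4)) (lincombᴾ (# 3)) refl

  unit-coordinate : ∀ l j → ιℤ (+ 102) * l (suc (inject₁ j))
                  ≡ ιℤ (+ 101) * lincomb l S (inject₁ j) - ιℤ (apex (inject₁ j)) * lincomb l S (# 3)
  unit-coordinate l zero             = prove (Vec.tabulate l) (102·lᴾ (# 1)) (unitRelationᴾ (# 0)) refl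
  unit-coordinate l (suc zero)       = prove (Vec.tabulate l) (102·lᴾ (# 2)) (unitRelationᴾ (# 1)) refl
  unit-coordinate l (suc (suc zero)) = prove (Vec.tabulate l) (102·lᴾ (# 3)) (unitRelationᴾ (# 2)) refl

S-affinelyIndependent : AffinelyIndependent S
S-affinelyIndependent l ∑l≡0 x≡0 = l≡0
  where
  unit≡0 : ∀ j → l (suc (inject₁ j)) ≡ 0ℚ
  unit≡0 j = *≡0⇒≡0 (ιℤ (+ 102)) (begin
    ιℤ (+ 102) * l (suc (inject₁ j))                        ≡⟨ unit-coordinate l j ⟩
    ιℤ (+ 101) * lincomb l S (inject₁ j) - c * lincomb l S (# 3) ≡⟨ cong₂ (λ u v → ιℤ (+ 101) * u - c * v) (x≡0 (inject₁ j)) (x≡0 (# 3)) ⟩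
    ιℤ (+ 101) * 0ℚ - c * 0ℚ                                ≡⟨ cong₂ _-_ (ℚP.*-zeroʳ (ιℤ (+ 101))) (ℚP.*-zeroʳ c) ⟩
    0ℚ - 0ℚ                                                 ≡⟨⟩
    0ℚ                                                      ∎)
    where
    open ≡-Reasoning
    c = ιℤ (apex (inject₁ j))
  l≡0-suc : ∀ i → l (suc i) ≡ 0ℚ
  l≡0-suc zero                   = unit≡0 (# 0)
  l≡0-suc (suc zero)             = unit≡0 (# 1)
  l≡0-suc (suc (suc zero))       = unit≡0 (# 2)
  l≡0-suc (suc (suc (suc zero))) = *≡0⇒≡0 (ιℤ (+ 102)) (trans (apex-coordinate l) (x≡0 (# 3)))
  l≡0 : ∀ i → l i ≡ 0ℚ
  l≡0 zero    = begin
    l zero                    ≡⟨ sym (ℚP.+-identityʳ (l zero)) ⟩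
    l zero + 0ℚ               ≡⟨ cong (λ r → l zero + r) (sym (∑-zero 4 (l ∘ suc) l≡0-suc)) ⟩
    l zero + ∑ 4 (l ∘ suc)    ≡⟨ ∑l≡0 ⟩
    0ℚ                        ∎
    where open ≡-Reasoning
  l≡0 (suc i) = l≡0-suc i

-- Hollowness

∣+⇒∸%≤ : ∀ m {n} a .{{_ : ℕ.NonZero m}} → m ℕD.∣ n ℕ.+ a → 0 ℕ.< n → m ℕ.∸ a ℕ.% m ℕ.≤ n
∣+⇒∸%≤ m {n} a m∣n+a 0<n =
  ℕP.m≤n+o⇒m∸n≤o m (a ℕ.% m) (ℕD.∣⇒≤ {{ℕ.>-nonZero 0<a%m+n}} m∣a%m+n)
  where
  0<a%m+n : 0 ℕ.< a ℕ.% m ℕ.+ n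
  0<a%m+n = ℕP.<-≤-trans 0<n (ℕP.m≤n+m n (a ℕ.% m))
  split : n ℕ.+ a ≡ a ℕ./ m ℕ.* m ℕ.+ (a ℕ.% m ℕ.+ n)
  split = trans (cong (n ℕ.+_) (ℕDM.m≡m%n+[m/n]*n a m)) (reorder n (a ℕ.% m) (a ℕ./ m ℕ.* m))
    where
    reorder : ∀ n r q → n ℕ.+ (r ℕ.+ q) ≡ q ℕ.+ (r ℕ.+ n)
    reorder = ℕSolver.solve-∀
  m∣a%m+n : m ℕD.∣ a ℕ.% m ℕ.+ n
  m∣a%m+n = ℕD.∣m+n∣m⇒∣n (subst (m ℕD.∣_) split m∣n+a) (ℕD.n∣m*n (a ℕ./ m))

-- the least positive n with 101 ∣ n + c·t
leastSolution : ℕ → ℕ → ℕ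
leastSolution c t = 101 ℕ.∸ (c ℕ.* t) ℕ.% 101

residueBound : ℕ → ℕ
residueBound t = leastSolution 6 t ℕ.+ (leastSolution 14 t ℕ.+ (leastSolution 17 t ℕ.+ t))

102≤residueBound : ∀ t → 102 ℕ.≤ residueBound t
102≤residueBound t with t ℕ.<? 102
... | yes t<102 = from-yes (ℕP.allUpTo? (λ s → 102 ℕ.≤? residueBound s) 102) t<102
... | no  t≮102 = ℕP.≤-trans (ℕP.≮⇒≥ t≮102) (begin
  t                                 ≤⟨ ℕP.m≤n+m t (leastSolution 17 t) ⟩
  leastSolution 17 t ℕ.+ t          ≤⟨ ℕP.m≤n+m _ (leastSolution 14 t) ⟩
  leastSolution 14 t ℕ.+ (leastSolution 17 t ℕ.+ t) ≤⟨ ℕP.m≤n+m _ (leastSolution 6 t) ⟩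
  residueBound t                    ∎)
  where open ℕP.≤-Reasoning

residues-sum-≥ : ∀ n₁ n₂ n₃ t → 0 ℕ.< n₁ → 0 ℕ.< n₂ → 0 ℕ.< n₃ →
  101 ℕD.∣ n₁ ℕ.+ 6 ℕ.* t → 101 ℕD.∣ n₂ ℕ.+ 14 ℕ.* t → 101 ℕD.∣ n₃ ℕ.+ 17 ℕ.* t →
  102 ℕ.≤ n₁ ℕ.+ (n₂ ℕ.+ (n₃ ℕ.+ t))
residues-sum-≥ n₁ n₂ n₃ t p₁ p₂ p₃ d₁ d₂ d₃ =
  ℕP.≤-trans (102≤residueBound t)
    (ℕP.+-mono-≤ (∣+⇒∸%≤ 101 (6 ℕ.* t) d₁ p₁)
      (ℕP.+-mono-≤ (∣+⇒∸%≤ 101 (14 ℕ.* t) d₂ p₂)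
        (ℕP.+-mono-≤ (∣+⇒∸%≤ 101 (17 ℕ.* t) d₃ p₃) ℕP.≤-refl)))

positive⇒+suc : ∀ {i} → + 0 ℤ.< i → Σ ℕ λ n → i ≡ + ℕ.suc n
positive⇒+suc {+ ℕ.suc n} _ = n , refl
positive⇒+suc {+ ℕ.zero} (ℤ.+<+ ())
positive⇒+suc { -[1+ n ]} ()

+≡101*⇒101∣ : ∀ {m} z → + m ≡ + 101 ℤ.* z → 101 ℕD.∣ m
+≡101*⇒101∣ z m≡101z =
  ℕD.divides ℤ.∣ z ∣ (trans (cong ℤ.∣_∣ m≡101z) (trans (ℤP.abs-* (+ 101) z) (ℕP.*-comm 101 ℤ.∣ z ∣)))

no-interior-integers : ∀ n₁ n₂ n₃ t z₁ z₂ z₃ → + 0 ℤ.< n₁ → + 0 ℤ.< n₂ → + 0 ℤ.< n₃ → + 0 ℤ.< t →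
  n₁ ℤ.+ + 6 ℤ.* t ≡ + 101 ℤ.* z₁ → n₂ ℤ.+ + 14 ℤ.* t ≡ + 101 ℤ.* z₂ → n₃ ℤ.+ + 17 ℤ.* t ≡ + 101 ℤ.* z₃ →
  n₁ ℤ.+ (n₂ ℤ.+ (n₃ ℤ.+ t)) ℤ.< + 102 → ⊥
no-interior-integers _ _ _ _ z₁ z₂ z₃ p₁ p₂ p₃ pₜ e₁ e₂ e₃ sum<102
  with positive⇒+suc p₁ | positive⇒+suc p₂ | positive⇒+suc p₃ | positive⇒+suc pₜ
... | m₁ , refl | m₂ , refl | m₃ , refl | s , refl =
  ℕP.<⇒≱ (ℤP.drop‿+<+ sum<102)
    (residues-sum-≥ (ℕ.suc m₁) (ℕ.suc m₂) (ℕ.suc m₃) (ℕ.suc s) ℕ.z<s ℕ.z<s ℕ.z<s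
      (+≡101*⇒101∣ z₁ e₁) (+≡101*⇒101∣ z₂ e₂) (+≡101*⇒101∣ z₃ e₃))

S-hollow : Hollow S
S-hollow z (l , l>0 , ∑l≡1 , x≡z) =
  no-interior-integers (N (# 0)) (N (# 1)) (N (# 2)) (z (# 3)) (z (# 0)) (z (# 1)) (z (# 2))
    (positive (N (# 0)) (ιN (# 0))) (positive (N (# 1)) (ιN (# 1))) (positive (N (# 2)) (ιN (# 2)))
    (positive (z (# 3)) ιt)
    (congruence (# 0)) (congruence (# 1)) (congruence (# 2))
    sum<102
  where
  -- N j and z (# 3) are 102 times the barycentric coordinates of z at the vertices
  -- suc (inject₁ j) and # 4 of S.
  N : Fin 3 → ℤ
  N j = + 101 ℤ.* z (inject₁ j) ℤ.- apex (inject₁ j) ℤ.* z (# 3)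

  ιN : ∀ j → ιℤ (N j) ≡ ιℤ (+ 102) * l (suc (inject₁ j))
  ιN j = begin
    ιℤ (N j)
      ≡⟨ ιℤ-- (+ 101 ℤ.* z (inject₁ j)) (c ℤ.* z (# 3)) ⟩
    ιℤ (+ 101 ℤ.* z (inject₁ j)) - ιℤ (c ℤ.* z (# 3))
      ≡⟨ cong₂ _-_ (ιℤ-* (+ 101) (z (inject₁ j))) (ιℤ-* c (z (# 3))) ⟩
    ιℤ (+ 101) * ιℤ (z (inject₁ j)) - ιℤ c * ιℤ (z (# 3))
      ≡⟨ sym (cong₂ (λ u v → ιℤ (+ 101) * u - ιℤ c * v) (x≡z (inject₁ j)) (x≡z (# 3))) ⟩
    ιℤ (+ 101) * lincomb l S (inject₁ j) - ιℤ c * lincomb l S (# 3)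
      ≡⟨ sym (unit-coordinate l j) ⟩
    ιℤ (+ 102) * l (suc (inject₁ j))
      ∎
    where
    open ≡-Reasoning
    c = apex (inject₁ j)

  ιt : ιℤ (z (# 3)) ≡ ιℤ (+ 102) * l (# 4)
  ιt = trans (sym (x≡z (# 3))) (sym (apex-coordinate l))

  positive : ∀ n {i} → ιℤ n ≡ ιℤ (+ 102) * l i → + 0 ℤ.< n
  positive n {i} ιn≡ = ιℤ-cancel-< (subst (0ℚ <_) (sym ιn≡) (ℚP.*-monoʳ-<-pos (ιℤ (+ 102)) (l>0 i)))

  congruence : ∀ j → N j ℤ.+ apex (inject₁ j) ℤ.* z (# 3) ≡ + 101 ℤ.* z (inject₁ j)
  congruence j = minus-plus (+ 101 ℤ.* z (inject₁ j)) (apex (inject₁ j) ℤ.* z (# 3))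
    where
    minus-plus : ∀ a b → a ℤ.- b ℤ.+ b ≡ a
    minus-plus = solve-∀

  rest<1 : ∑ 4 (l ∘ suc) < 1ℚ
  rest<1 = subst₂ _<_ (ℚP.+-identityˡ (∑ 4 (l ∘ suc))) ∑l≡1 (ℚP.+-monoˡ-< (∑ 4 (l ∘ suc)) (l>0 zero))

  sum<102 : N (# 0) ℤ.+ (N (# 1) ℤ.+ (N (# 2) ℤ.+ z (# 3))) ℤ.< + 102
  sum<102 = ιℤ-cancel-< (begin-strict
    ιℤ (N (# 0) ℤ.+ (N (# 1) ℤ.+ (N (# 2) ℤ.+ z (# 3))))
      ≡⟨ ιℤ-+ (N (# 0)) (N (# 1) ℤ.+ (N (# 2) ℤ.+ z (# 3))) ⟩
    ιℤ (N (# 0)) + ιℤ (N (# 1) ℤ.+ (N (# 2) ℤ.+ z (# 3)))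
      ≡⟨ cong₂ _+_ (ιN (# 0)) (trans (ιℤ-+ (N (# 1)) (N (# 2) ℤ.+ z (# 3)))
                                    (cong₂ _+_ (ιN (# 1)) (trans (ιℤ-+ (N (# 2)) (z (# 3))) (cong₂ _+_ (ιN (# 2)) ιt)))) ⟩
    c * l (# 1) + (c * l (# 2) + (c * l (# 3) + c * l (# 4)))
      ≡⟨ factor c (l (# 1)) (l (# 2)) (l (# 3)) (l (# 4)) ⟩
    c * ∑ 4 (l ∘ suc)
      <⟨ ℚP.*-monoʳ-<-pos c rest<1 ⟩
    ιℤ (+ 102) ∎)
    where
    open ℚP.≤-Reasoning
    c = ιℤ (+ 102)
    factor : ∀ c a b d e → c * a + (c * b + (c * d + c * e)) ≡ c * (a + (b + (d + (e + 0ℚ))))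
    factor = solve 5 (λ c a b d e → c :* a :+ (c :* b :+ (c :* d :+ c :* e)) := c :* (a :+ (b :+ (d :+ (e :+ con 0ℚ))))) refl
      where open ℚSolver.+-*-Solver

lemma6p1 : Σ (Simplex 4) λ S → AffinelyIndependent S × Hollow S × LatticeWidthIs S ((+ 408) / 101) × HasLatticeVertex S × DilationIsLattice ((+ 101) / 1) S
lemma6p1 = S , S-affinelyIndependent , S-hollow , (widthIn-S-≥ , widthIn-S-approached) , S-vertex₀ , 101•S-integral
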